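{- Let $x\in\mathbb{R}_{\geq 0}$. Consider the LDC network with nodes $g,l,v$ and edges $(g,v)$ of susceptance $1$ and capacity $x$, $(g,l)$ of susceptance $1$ and capacity $2x$, and $(v,l)$ of susceptance $1$ and capacity $x$, where $g$ is a generator and $l$ is a load. Let $N^-$ be the version in which $v$ is additionally a load and $N^+$ the version in which $v$ is additionally a generator. Then: (1) $\mathrm{MSF}(N^-)=3x$; (2) $\{\ell(v) : (E',S,\theta,F,g,\ell)\text{ is an optimal solution of }\mathrm{MSF}(N^-)\}=\{0,x\}$; (3) for every optimal solution of $\mathrm{MSF}(N^+)$, if the generation at $v$ is positive then the generation at $g$ is strictly less than $3x$.
   Context: An LDC network is a tuple $N=(B,G,L,E)$: nodes $B$, generators $G\subseteq B$, loads $L\subseteq B\setminus G$, and edges each joining a pair of distinct nodes with a fixed susceptance $s(e)\geq0$ and capacity $c(e)\geq 0$ (at most one edge per pair), each edge with a fixed orientation $(a,b)$. A solution is $(\theta,F,g,\ell)$ with phase angles $\theta:B\to\mathbb{R}$, flows $F:E\to\mathbb{R}$, generation $g:B\to\mathbb{R}_{\geq0}$ (zero off $G$), load $\ell:B\to\mathbb{R}_{\geq0}$ (zero off $L$), satisfying Kirchhoff's law $\sum_{(a,b)\in E}F(a,b)-\sum_{(b,a)\in E}F(b,a)=g(a)-\ell(a)$ at every node $a$, the power law $F(a,b)=s(a,b)(\theta(b)-\theta(a))$ on every edge, and $|F(e)|\leq c(e)$. $\mathrm{MPF}(N)$ is the maximum of $\sum_{a\in B}g(a)$ over solutions. $\mathrm{MSF}(N)=\max_{E'\subseteq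 E}\mathrm{MPF}(N[E'])$, where $N[E']$ removes the edges $E'$. An optimal solution of $\mathrm{MSF}(N)$ is a pair consisting of a set $E'$ with $\mathrm{MPF}(N[E'])=\mathrm{MSF}(N)$ and a solution of $N[E']$ attaining $\mathrm{MPF}(N[E'])$. -}

module Defs where

open import Level using (0ℓ)
open import Data.Bool using (Bool; true; false; not; _∧_; if_then_else_)
open import Data.Nat using (ℕ; zero; suc)
open import Data.Fin using (Fin; zero; suc; _≟_)
open import Data.Product using (Σ; _×_; _,_; ∃)
open import Relation.Nullary using (¬_; does)
open import Relation.Binary.PropositionalEquality using (_≡_; _≢_)
open import Relation.Binary.Structures using (IsTotalOrder)
open import Algebra.Structures using (IsCommutativeRing)

-- Ordered fields (stand-in for ℝ, which agda-stdlib lacks).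
-- Equality is propositional equality; ordering is a total order
-- compatible with + and *; nonzero elements have inverses.

record OrderedField : Set₁ where
  infixl 6 _+_
  infixl 7 _*_
  infix 4 _≤_ _<_
  field
    Carrier : Set
    _+_ _*_ : Carrier → Carrier → Carrier
    -_      : Carrier → Carrier
    0# 1#   : Carrier
    _≤_     : Carrier → Carrier → Set
    isCommutativeRing : IsCommutativeRing _≡_ _+_ _*_ -_ 0# 1#
    isTotalOrder      : IsTotalOrder _≡_ _≤_
    +-mono-≤   : ∀ {a b} c → a ≤ b → a + c ≤ b + c
    *-nonneg   : ∀ {a b} → 0# ≤ a → 0# ≤ b → 0# ≤ a * b
    0≢1        : 0# ≢ 1#
    inverse    : ∀ a → a ≢ 0# → Σ Carrier (λ b → a * b ≡ 1#)

  _<_ : Carrier → Carrier → Set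
  a < b = (a ≤ b) × (a ≢ b)

  _-_ : Carrier → Carrier → Carrier
  a - b = a + (- b)

module LDC (R : OrderedField) where
  open OrderedField R

  sumFin : (n : ℕ) → (Fin n → Carrier) → Carrier
  sumFin zero    f = 0#
  sumFin (suc n) f = f zero + sumFin n (λ i → f (suc i))

  record Network : Set where
    field
      nodes edges : ℕ
      src tgt     : Fin edges → Fin nodes
      susc cap    : Fin edges → Carrier
      isGen isLoad : Fin nodes → Bool

  -- An edge set E' ⊆ E is given by its indicator (true = removed).
  EdgeSet : Network → Set
  EdgeSet N = Fin (Network.edges N) → Bool

  -- Solutions of N[E'] (the network N with the edges in E' removed).
  -- Flows on removed edges play no role.
  record Solution (N : Network) (E' : EdgeSet N) : Set where
    open Network N
    kept : Fin edges → Bool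
    kept e = not (E' e)
    field
      θ   : Fin nodes → Carrier
      F   : Fin edges → Carrier
      gen load : Fin nodes → Carrier
      gen-nonneg  : ∀ a → 0# ≤ gen a
      load-nonneg : ∀ a → 0# ≤ load a
      gen-off  : ∀ a → isGen a ≡ false → gen a ≡ 0#
      load-off : ∀ a → isLoad a ≡ false → load a ≡ 0#
      kirchhoff : ∀ a →
        sumFin edges (λ e → if kept e ∧ does (src e ≟ a) then F e else 0#)
        - sumFin edges (λ e → if kept e ∧ does (tgt e ≟ a) then F e else 0#)
        ≡ gen a - load a
      power : ∀ e → kept e ≡ true → F e ≡ susc e * (θ (tgt e) - θ (src e))
      cap-upper : ∀ e → kept e ≡ true → F e ≤ cap e
      cap-lower : ∀ e → kept e ≡ true → - (cap e) ≤ F e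

  totalGen : ∀ {N E'} → Solution N E' → Carrier
  totalGen {N} s = sumFin (Network.nodes N) (Solution.gen s)

  -- (E' , S) is an optimal solution of MSF(N): S is a solution of N[E'] whose
  -- total generation is at least that of every solution of every N[E''].
  -- (Equivalently MPF(N[E']) = MSF(N) and S attains MPF(N[E']).)
  record OptimalMSF (N : Network) : Set where
    field
      removed  : EdgeSet N
      solution : Solution N removed
      optimal  : ∀ (E'' : EdgeSet N) (S' : Solution N E'') →
                 totalGen S' ≤ totalGen solution

  MSF≡ : Network → Carrier → Set
  MSF≡ N v =
    Σ (EdgeSet N) (λ E' → Σ (Solution N E') (λ S → totalGen S ≡ v))
    × (∀ (E'' : EdgeSet N) (S' : Solution N E'') → totalGen S' ≤ v)

  -- The concrete network: nodes g = 0, l = 1, v = 2;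
  -- edges 0 = (g,v) [s=1, c=x], 1 = (g,l) [s=1, c=2x], 2 = (v,l) [s=1, c=x].

  nodeG nodeL nodeV : Fin 3
  nodeG = zero
  nodeL = suc zero
  nodeV = suc (suc zero)

  exSrc exTgt : Fin 3 → Fin 3
  exSrc zero = nodeG
  exSrc (suc zero) = nodeG
  exSrc (suc (suc zero)) = nodeV
  exTgt zero = nodeV
  exTgt (suc zero) = nodeL
  exTgt (suc (suc zero)) = nodeL

  exCap : Carrier → Fin 3 → Carrier
  exCap x zero = x
  exCap x (suc zero) = x + x
  exCap x (suc (suc zero)) = x

  exGen : Bool → Fin 3 → Bool
  exGen vGen zero = true
  exGen vGen (suc zero) = false
  exGen vGen (suc (suc zero)) = vGen

  exLoad : Bool → Fin 3 → Bool
  exLoad vLoad zero = false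
  exLoad vLoad (suc zero) = true
  exLoad vLoad (suc (suc zero)) = vLoad

  Nminus : Carrier → Network
  Nminus x = record
    { nodes = 3 ; edges = 3 ; src = exSrc ; tgt = exTgt
    ; susc = λ _ → 1# ; cap = exCap x
    ; isGen = exGen false ; isLoad = exLoad true }

  Nplus : Carrier → Network
  Nplus x = record
    { nodes = 3 ; edges = 3 ; src = exSrc ; tgt = exTgt
    ; susc = λ _ → 1# ; cap = exCap x
    ; isGen = exGen true ; isLoad = exLoad false }

module Submission where

-- Write f_gv, f_gl, f_vl for the flows on the edges that are kept (0 on
-- removed edges).  Kirchhoff's law at g and v gives
--   g(g) = f_gv + f_gl   and   f_vl - f_gv = g(v) - ℓ(v),
-- and the capacities bound every flow.  Hence g(g) ≤ 3x always, which is
-- attained both with all edges kept and with (v,l) removed; this gives (1)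
-- and the two witnesses for (2).  An optimal solution of N⁻ has g(g) = 3x,
-- so both edges at g are saturated, and ℓ(v) = x - f_vl.  Either (v,l) is
-- removed (f_vl = 0), or the power law around the cycle gives
-- f_gv + f_vl = f_gl, i.e. f_vl = x, or some edge at g is removed, forcing
-- x = 0.  For (3), in N⁺ we get g(g) + g(v) = f_gl + f_vl ≤ 3x.

open import Defs
open import Data.Bool using (Bool; true; false; _∧_; if_then_else_)
open import Data.Nat using (zero; suc)
open import Data.Fin using (Fin; zero; suc; _≟_)
open import Data.Product using (Σ; _×_; _,_; proj₁; proj₂)
open import Data.Sum using (_⊎_; inj₁; inj₂)
open import Relation.Nullary using (does)
open import Relation.Binary.PropositionalEquality
  using (_≡_; refl; sym; trans; cong; cong₂; subst; subst₂; module ≡-Reasoning)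
open import Relation.Binary.Structures using (IsTotalOrder)
open import Algebra.Bundles using (CommutativeRing)
import Algebra.Properties.AbelianGroup as AbelianGroupProperties

module OrderedFieldFacts (R : OrderedField) where
  open OrderedField R
  open IsTotalOrder isTotalOrder public using (antisym; reflexive) renaming (trans to ≤-trans)

  commutativeRing : CommutativeRing _ _
  commutativeRing = record { isCommutativeRing = isCommutativeRing }

  open CommutativeRing commutativeRing public
    using (+-comm; +-assoc; +-identityˡ; +-identityʳ; *-identityˡ)
  open CommutativeRing commutativeRing using (+-abelianGroup)
  open AbelianGroupProperties +-abelianGroup public
    using (ε⁻¹≈ε; ⁻¹-anti-homo‿-; //-rightDividesʳ; x≈y⇒x∙y⁻¹≈ε; ∙-cancelˡ; ∙-cancelʳ)

  -- Normalisation of semiring expressions (negations are treated as atoms).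
  module Normalise where
    open import Algebra.Solver.Ring.NaturalCoefficients.Default
      (CommutativeRing.commutativeSemiring commutativeRing) public

  ≤-refl : ∀ {a} → a ≤ a
  ≤-refl = reflexive refl

  sub-zero : ∀ a → a - 0# ≡ a
  sub-zero a = trans (cong (a +_) ε⁻¹≈ε) (+-identityʳ a)

  sub-self : ∀ a → a - a ≡ 0#
  sub-self a = x≈y⇒x∙y⁻¹≈ε refl

  add-sub-cancel : ∀ a b → a + (b - a) ≡ b
  add-sub-cancel a b = begin
    a + (b - a)   ≡⟨ +-comm a (b - a) ⟩
    (b - a) + a   ≡⟨ +-assoc b (- a) a ⟩
    b + (- a + a) ≡⟨ cong (b +_) (trans (+-comm (- a) a) (sub-self a)) ⟩
    b + 0#        ≡⟨ +-identityʳ b ⟩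
    b             ∎
    where open ≡-Reasoning

  swap-summand : ∀ a b c → (a + b) + (c - a) ≡ b + c
  swap-summand a b c = begin
    (a + b) + (c - a) ≡⟨ cong (_+ (c - a)) (+-comm a b) ⟩
    (b + a) + (c - a) ≡⟨ +-assoc b a (c - a) ⟩
    b + (a + (c - a)) ≡⟨ cong (b +_) (add-sub-cancel a c) ⟩
    b + c             ∎
    where open ≡-Reasoning

  telescope : ∀ a b c → (b - a) + (c - b) ≡ c - a
  telescope a b c = begin
    (b - a) + (c - b) ≡⟨ +-comm (b - a) (c - b) ⟩
    (c - b) + (b - a) ≡⟨ +-assoc c (- b) (b - a) ⟩
    c + (- b + (b - a)) ≡⟨ cong (c +_) (sym (+-assoc (- b) b (- a))) ⟩
    c + ((- b + b) - a) ≡⟨ cong (λ t → c + (t - a)) (trans (+-comm (- b) b) (sub-self b)) ⟩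
    c + (0# - a)      ≡⟨ cong (c +_) (+-identityˡ (- a)) ⟩
    c - a             ∎
    where open ≡-Reasoning

  +-mono : ∀ {a b c d} → a ≤ b → c ≤ d → a + c ≤ b + d
  +-mono {a} {b} {c} {d} a≤b c≤d =
    ≤-trans (+-mono-≤ c a≤b) (subst₂ _≤_ (+-comm c b) (+-comm d b) (+-mono-≤ b c≤d))

  +-cancelʳ-≤ : ∀ {a b} c → a + c ≤ b + c → a ≤ b
  +-cancelʳ-≤ {a} {b} c p =
    subst₂ _≤_ (//-rightDividesʳ c a) (//-rightDividesʳ c b) (+-mono-≤ (- c) p)

  nonpos-if-no-gain : ∀ {a c} → a + c ≤ a → c ≤ 0#
  nonpos-if-no-gain {a} {c} p =
    +-cancelʳ-≤ a (subst₂ _≤_ (+-comm a c) (sym (+-identityˡ a)) p)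

  neg-antitone : ∀ {a b} → a ≤ b → - b ≤ - a
  neg-antitone {a} {b} a≤b = subst₂ _≤_ lhs rhs (+-mono-≤ ((- a) - b) a≤b)
    where
    lhs : a + ((- a) - b) ≡ - b
    lhs = trans (sym (+-assoc a (- a) (- b)))
                (trans (cong (_- b) (sub-self a)) (+-identityˡ (- b)))
    rhs : b + ((- a) - b) ≡ - a
    rhs = add-sub-cancel b (- a)

  neg-nonneg : ∀ {a} → 0# ≤ a → - a ≤ 0#
  neg-nonneg 0≤a = subst (_ ≤_) ε⁻¹≈ε (neg-antitone 0≤a)

  neg≤self : ∀ {a} → 0# ≤ a → - a ≤ a
  neg≤self 0≤a = ≤-trans (neg-nonneg 0≤a) 0≤a

  nonneg-+ : ∀ {a b} → 0# ≤ a → 0# ≤ b → 0# ≤ a + b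
  nonneg-+ 0≤a 0≤b = subst (_≤ _) (+-identityʳ 0#) (+-mono 0≤a 0≤b)

  sum-tight : ∀ {a b c d} → a ≤ c → b ≤ d → a + b ≡ c + d → (a ≡ c) × (b ≡ d)
  sum-tight {a} {b} {c} {d} a≤c b≤d sum≡ = ∙-cancelʳ b a c a+b≡c+b , b≡d
    where
    d≤b : d ≤ b
    d≤b = +-cancelʳ-≤ c
      (subst₂ _≤_ (trans sum≡ (+-comm c d)) (+-comm c b) (+-mono-≤ b a≤c))
    b≡d : b ≡ d
    b≡d = antisym b≤d d≤b
    a+b≡c+b : a + b ≡ c + b
    a+b≡c+b = trans sum≡ (cong (c +_) (sym b≡d))

  squeeze-zero : ∀ {a y} → a ≡ 0# → - a ≤ y → y ≤ a → y ≡ 0#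
  squeeze-zero {a} {y} a≡0 lo up =
    antisym (subst (y ≤_) a≡0 up) (subst (_≤ y) (trans (cong -_ a≡0) ε⁻¹≈ε) lo)

module NetworkFacts (R : OrderedField) where
  open OrderedField R
  open LDC R
  open OrderedFieldFacts R

  flow : ∀ {N E'} → Solution N E' → Fin (Network.edges N) → Carrier
  flow S e = if Solution.kept S e then Solution.F S e else 0#

  module _ {N : Network} {E' : EdgeSet N} (S : Solution N E') where
    open Network N
    open Solution S

    flow-kept : ∀ e → kept e ≡ true → flow S e ≡ F e
    flow-kept e k rewrite k = refl

    flow-removed : ∀ e → kept e ≡ false → flow S e ≡ 0#
    flow-removed e k rewrite k = refl

    flow-upper : (∀ e → 0# ≤ cap e) → ∀ e → flow S e ≤ cap e
    flow-upper cap≥0 e with kept e in k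
    ... | true  = cap-upper e k
    ... | false = cap≥0 e

    flow-lower : (∀ e → 0# ≤ cap e) → ∀ e → - cap e ≤ flow S e
    flow-lower cap≥0 e with kept e in k
    ... | true  = cap-lower e k
    ... | false = neg-nonneg (cap≥0 e)

    kirchhoff-flow : ∀ a →
      sumFin edges (λ e → if does (src e ≟ a) then flow S e else 0#)
      - sumFin edges (λ e → if does (tgt e ≟ a) then flow S e else 0#)
      ≡ gen a - load a
    kirchhoff-flow a =
      trans (cong₂ _-_ (sum-cong (λ e → kept-inside (kept e) (does (src e ≟ a)) (F e)))
                       (sum-cong (λ e → kept-inside (kept e) (does (tgt e ≟ a)) (F e))))
            (kirchhoff a)
      where
      kept-inside : ∀ k i y → (if i then (if k then y else 0#) else 0#) ≡ (if k ∧ i then y else 0#)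
      kept-inside true  i     y = refl
      kept-inside false true  y = refl
      kept-inside false false y = refl

      sum-cong : ∀ {n} {f g : Fin n → Carrier} → (∀ i → f i ≡ g i) → sumFin n f ≡ sumFin n g
      sum-cong {zero}  f≗g = refl
      sum-cong {suc n} f≗g = cong₂ _+_ (f≗g zero) (sum-cong (λ i → f≗g (suc i)))

module Triangle (R : OrderedField) (x : OrderedField.Carrier R)
                (0≤x : OrderedField._≤_ R (OrderedField.0# R) x) where
  open OrderedField R
  open LDC R
  open OrderedFieldFacts R
  open NetworkFacts R
  open Normalise using (solve; _:=_; _:+_; con)

  -- v is a generator iff vGen and a load iff vLoad; N⁻ is triangle false true
  -- and N⁺ is triangle true false (definitionally).
  triangle : Bool → Bool → Network
  triangle vGen vLoad = record
    { nodes = 3 ; edges = 3 ; src = exSrc ; tgt = exTgt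
    ; susc = λ _ → 1# ; cap = exCap x
    ; isGen = exGen vGen ; isLoad = exLoad vLoad }

  edgeGV edgeGL edgeVL : Fin 3
  edgeGV = zero
  edgeGL = suc zero
  edgeVL = suc (suc zero)

  0≤2x : 0# ≤ x + x
  0≤2x = nonneg-+ 0≤x 0≤x

  cap≥0 : ∀ e → 0# ≤ exCap x e
  cap≥0 zero             = 0≤x
  cap≥0 (suc zero)       = 0≤2x
  cap≥0 (suc (suc zero)) = 0≤x

  no-inflow : 0# + (0# + (0# + 0#)) ≡ 0#
  no-inflow = solve 0 (con 0 :+ (con 0 :+ (con 0 :+ con 0)) := con 0) refl

  module _ {vGen vLoad : Bool} {E' : EdgeSet (triangle vGen vLoad)}
           (S : Solution (triangle vGen vLoad) E') where
    open Solution S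

    balance-g : gen nodeG ≡ flow S edgeGV + flow S edgeGL
    balance-g = begin
      gen nodeG                ≡⟨ sym (sub-zero (gen nodeG)) ⟩
      gen nodeG - 0#           ≡⟨ cong (λ ℓ → gen nodeG - ℓ) (sym (load-off nodeG refl)) ⟩
      gen nodeG - load nodeG   ≡⟨ sym (kirchhoff-flow S nodeG) ⟩
      (f₀ + (f₁ + (0# + 0#))) - (0# + (0# + (0# + 0#)))
        ≡⟨ cong₂ _-_ (solve 2 (λ a b → a :+ (b :+ (con 0 :+ con 0)) := a :+ b) refl f₀ f₁)
                     no-inflow ⟩
      (f₀ + f₁) - 0#           ≡⟨ sub-zero (f₀ + f₁) ⟩
      f₀ + f₁                  ∎
      where
      open ≡-Reasoning
      f₀ f₁ : Carrier
      f₀ = flow S edgeGV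
      f₁ = flow S edgeGL

    balance-v : flow S edgeVL - flow S edgeGV ≡ gen nodeV - load nodeV
    balance-v = trans (cong₂ _-_ (solve 1 (λ a → a := con 0 :+ (con 0 :+ (a :+ con 0))) refl _)
                                 (solve 1 (λ a → a := a :+ (con 0 :+ (con 0 :+ con 0))) refl _))
                      (kirchhoff-flow S nodeV)

    gen-g-bound : gen nodeG ≤ x + x + x
    gen-g-bound = subst₂ _≤_ (sym balance-g) (sym (+-assoc x x x))
      (+-mono (flow-upper S cap≥0 edgeGV) (flow-upper S cap≥0 edgeGL))

    -- Around the cycle g → v → l the power law forces f_gv + f_vl = f_gl.
    cycle-law : kept edgeGV ≡ true → kept edgeGL ≡ true → kept edgeVL ≡ true →
                flow S edgeGV + flow S edgeVL ≡ flow S edgeGL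
    cycle-law k₀ k₁ k₂ = begin
      flow S edgeGV + flow S edgeVL
        ≡⟨ cong₂ _+_ (trans (flow-kept S edgeGV k₀) (power edgeGV k₀))
                     (trans (flow-kept S edgeVL k₂) (power edgeVL k₂)) ⟩
      1# * (θ nodeV - θ nodeG) + 1# * (θ nodeL - θ nodeV)
        ≡⟨ cong₂ _+_ (*-identityˡ _) (*-identityˡ _) ⟩
      (θ nodeV - θ nodeG) + (θ nodeL - θ nodeV)
        ≡⟨ telescope (θ nodeG) (θ nodeV) (θ nodeL) ⟩
      θ nodeL - θ nodeG
        ≡⟨ sym (trans (flow-kept S edgeGL k₁) (trans (power edgeGL k₁) (*-identityˡ _))) ⟩
      flow S edgeGL ∎
      where open ≡-Reasoning

  -- In N⁻ only g generates, so the total generation is the generation at g.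
  totalGen-minus : ∀ {E'} (S : Solution (Nminus x) E') → totalGen S ≡ Solution.gen S nodeG
  totalGen-minus S =
    trans (cong₂ (λ gl gv → Solution.gen S nodeG + (gl + (gv + 0#)))
                 (Solution.gen-off S nodeL refl) (Solution.gen-off S nodeV refl))
          (solve 1 (λ a → a :+ (con 0 :+ (con 0 :+ con 0)) := a) refl _)

  msf-upper : ∀ (E'' : EdgeSet (Nminus x)) (S : Solution (Nminus x) E'') →
              totalGen S ≤ x + x + x
  msf-upper E'' S = subst (_≤ x + x + x) (sym (totalGen-minus S)) (gen-g-bound S)

  saturating-optimal : ∀ {E'} (S : Solution (Nminus x) E') →
                       Solution.gen S nodeG ≡ x + x + x → OptimalMSF (Nminus x)
  saturating-optimal {E'} S g≡3x = record
    { removed = E' ; solution = S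
    ; optimal = λ E'' S' →
        subst (totalGen S' ≤_) (sym (trans (totalGen-minus S) g≡3x)) (msf-upper E'' S') }

  -- Witnesses: potentials 0, 2x, x at g, l, v drive flows x, 2x, x along
  -- (g,v), (g,l), (v,l), saturating every edge; g generates 3x.
  θ* F* gen* : Fin 3 → Carrier
  θ* zero               = 0#
  θ* (suc zero)         = x + x
  θ* (suc (suc zero))   = x
  F* zero               = x
  F* (suc zero)         = x + x
  F* (suc (suc zero))   = x
  gen* zero             = x + x + x
  gen* (suc zero)       = 0#
  gen* (suc (suc zero)) = 0#

  gen*-nonneg : ∀ a → 0# ≤ gen* a
  gen*-nonneg zero             = nonneg-+ 0≤2x 0≤x
  gen*-nonneg (suc zero)       = ≤-refl
  gen*-nonneg (suc (suc zero)) = ≤-refl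

  F*-saturates : ∀ e → F* e ≡ exCap x e
  F*-saturates zero             = refl
  F*-saturates (suc zero)       = refl
  F*-saturates (suc (suc zero)) = refl

  F*-upper : ∀ e → F* e ≤ exCap x e
  F*-upper e = reflexive (F*-saturates e)

  F*-lower : ∀ e → - exCap x e ≤ F* e
  F*-lower e = subst (λ f → - exCap x e ≤ f) (sym (F*-saturates e)) (neg≤self (cap≥0 e))

  power* : ∀ e → F* e ≡ 1# * (θ* (exTgt e) - θ* (exSrc e))
  power* zero             = sym (trans (*-identityˡ _) (sub-zero x))
  power* (suc zero)       = sym (trans (*-identityˡ _) (sub-zero (x + x)))
  power* (suc (suc zero)) = sym (trans (*-identityˡ _) (//-rightDividesʳ x x))

  -- Kirchhoff at g for the witnesses (removing (v,l) does not affect g).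
  balance-g* : (x + ((x + x) + (0# + 0#))) - (0# + (0# + (0# + 0#))) ≡ (x + x + x) - 0#
  balance-g* = cong₂ _-_ (solve 1 (λ a → a :+ ((a :+ a) :+ (con 0 :+ con 0)) := a :+ a :+ a) refl x)
                         no-inflow

  keep-all cut-vl : EdgeSet (Nminus x)
  keep-all _              = false
  cut-vl zero             = false
  cut-vl (suc zero)       = false
  cut-vl (suc (suc zero)) = true

  -- All edges kept: l absorbs 3x and v is a pure transit node, ℓ(v) = 0.
  through-v : Solution (Nminus x) keep-all
  through-v = record
    { θ = θ* ; F = F* ; gen = gen* ; load = load
    ; gen-nonneg = gen*-nonneg
    ; load-nonneg = λ { zero → ≤-refl ; (suc zero) → gen*-nonneg zero ; (suc (suc zero)) → ≤-refl }
    ; gen-off = λ { zero () ; (suc zero) _ → refl ; (suc (suc zero)) _ → refl }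
    ; load-off = λ { zero _ → refl ; (suc zero) () ; (suc (suc zero)) () }
    ; kirchhoff = λ
        { zero → balance-g*
        ; (suc zero) → cong₂ _-_ no-inflow
            (solve 1 (λ a → con 0 :+ ((a :+ a) :+ (a :+ con 0)) := a :+ a :+ a) refl x)
        ; (suc (suc zero)) →
            trans (cong₂ _-_ (solve 1 (λ a → con 0 :+ (con 0 :+ (a :+ con 0)) := a) refl x)
                             (solve 1 (λ a → a :+ (con 0 :+ (con 0 :+ con 0)) := a) refl x))
                  (trans (sub-self x) (sym (sub-self 0#))) }
    ; power = λ e _ → power* e
    ; cap-upper = λ e _ → F*-upper e
    ; cap-lower = λ e _ → F*-lower e }
    where
    load : Fin 3 → Carrier
    load zero             = 0#
    load (suc zero)       = x + x + x
    load (suc (suc zero)) = 0#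

  -- (v,l) removed: l absorbs 2x and v absorbs x, ℓ(v) = x.
  absorbed-at-v : Solution (Nminus x) cut-vl
  absorbed-at-v = record
    { θ = θ* ; F = F* ; gen = gen* ; load = load
    ; gen-nonneg = gen*-nonneg
    ; load-nonneg = λ { zero → ≤-refl ; (suc zero) → 0≤2x ; (suc (suc zero)) → 0≤x }
    ; gen-off = λ { zero () ; (suc zero) _ → refl ; (suc (suc zero)) _ → refl }
    ; load-off = λ { zero _ → refl ; (suc zero) () ; (suc (suc zero)) () }
    ; kirchhoff = λ
        { zero → balance-g*
        ; (suc zero) → cong₂ _-_ no-inflow
            (solve 1 (λ a → con 0 :+ ((a :+ a) :+ (con 0 :+ con 0)) := a :+ a) refl x)
        ; (suc (suc zero)) → cong₂ _-_ no-inflow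
            (solve 1 (λ a → a :+ (con 0 :+ (con 0 :+ con 0)) := a) refl x) }
    ; power = λ e _ → power* e
    ; cap-upper = λ e _ → F*-upper e
    ; cap-lower = λ e _ → F*-lower e }
    where
    load : Fin 3 → Carrier
    load zero             = 0#
    load (suc zero)       = x + x
    load (suc (suc zero)) = x

  msf-minus : MSF≡ (Nminus x) (x + x + x)
  msf-minus = (keep-all , through-v , totalGen-minus through-v) , msf-upper

  optimal-through-v : OptimalMSF (Nminus x)
  optimal-through-v = saturating-optimal through-v refl

  optimal-absorbed-at-v : OptimalMSF (Nminus x)
  optimal-absorbed-at-v = saturating-optimal absorbed-at-v refl

  module _ (O : OptimalMSF (Nminus x)) where
    open OptimalMSF O using (solution; optimal)
    open Solution solution

    optimal-gen-g : gen nodeG ≡ x + x + x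
    optimal-gen-g = antisym (gen-g-bound solution)
      (subst₂ _≤_ (totalGen-minus through-v) (totalGen-minus solution)
              (optimal keep-all through-v))

    saturated : (flow solution edgeGV ≡ x) × (flow solution edgeGL ≡ x + x)
    saturated = sum-tight (flow-upper solution cap≥0 edgeGV) (flow-upper solution cap≥0 edgeGL)
      (trans (sym (balance-g solution)) (trans optimal-gen-g (+-assoc x x x)))

    -- v only consumes, so ℓ(v) = f_gv - f_vl.
    load-v : load nodeV ≡ flow solution edgeGV - flow solution edgeVL
    load-v = begin
      load nodeV                      ≡⟨ sym (sub-zero (load nodeV)) ⟩
      load nodeV - 0#                 ≡⟨ sym (⁻¹-anti-homo‿- 0# (load nodeV)) ⟩
      - (0# - load nodeV)             ≡⟨ cong (λ t → - (t - load nodeV)) (sym (gen-off nodeV refl)) ⟩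
      - (gen nodeV - load nodeV)      ≡⟨ cong -_ (sym (balance-v solution)) ⟩
      - (flow solution edgeVL - flow solution edgeGV)
        ≡⟨ ⁻¹-anti-homo‿- (flow solution edgeVL) (flow solution edgeGV) ⟩
      flow solution edgeGV - flow solution edgeVL ∎
      where open ≡-Reasoning

    no-capacity : x ≡ 0# → flow solution edgeVL ≡ 0#
    no-capacity x≡0 =
      squeeze-zero x≡0 (flow-lower solution cap≥0 edgeVL) (flow-upper solution cap≥0 edgeVL)

    -- With both edges at g saturated, (v,l) carries either nothing or x:
    -- nothing if it is removed; x by the cycle law if all edges are kept;
    -- and nothing if an edge at g is removed, since then x = 0.
    flow-vl-cases : (flow solution edgeVL ≡ 0#) ⊎ (flow solution edgeVL ≡ x)
    flow-vl-cases = by-kept (kept edgeVL) (kept edgeGV) (kept edgeGL) refl refl refl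
      where
      by-kept : ∀ b₂ b₀ b₁ → kept edgeVL ≡ b₂ → kept edgeGV ≡ b₀ → kept edgeGL ≡ b₁ →
                (flow solution edgeVL ≡ 0#) ⊎ (flow solution edgeVL ≡ x)
      by-kept false _     _     k₂ _  _  = inj₁ (flow-removed solution edgeVL k₂)
      by-kept true  true  true  k₂ k₀ k₁ = inj₂ (∙-cancelˡ x (flow solution edgeVL) x
        (trans (cong (_+ flow solution edgeVL) (sym (proj₁ saturated)))
               (trans (cycle-law solution k₀ k₁ k₂) (proj₂ saturated))))
      by-kept true  false _     _  k₀ _  = inj₁ (no-capacity
        (trans (sym (proj₁ saturated)) (flow-removed solution edgeGV k₀)))
      by-kept true  true  false _  _  k₁ = inj₁ (no-capacity (sym (proj₁ (sum-tight 0≤x 0≤x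
        (trans (+-identityʳ 0#) (trans (sym (flow-removed solution edgeGL k₁)) (proj₂ saturated)))))))

    load-v-cases : (load nodeV ≡ 0#) ⊎ (load nodeV ≡ x)
    load-v-cases with flow-vl-cases
    ... | inj₁ f≡0 = inj₂ (trans load-v (trans (cong (λ f → flow solution edgeGV - f) f≡0)
                                          (trans (sub-zero _) (proj₁ saturated))))
    ... | inj₂ f≡x = inj₁ (trans load-v (trans (cong₂ _-_ (proj₁ saturated) f≡x) (sub-self x)))

  module _ {E' : EdgeSet (Nplus x)} (S : Solution (Nplus x) E') where
    open Solution S

    -- In N⁺ all generation leaves along (g,l) and (v,l):
    -- g(g) + g(v) = f_gl + f_vl ≤ 3x.
    joint-generation-bound : gen nodeG + gen nodeV ≤ x + x + x
    joint-generation-bound = subst (_≤ x + x + x) (sym joint-generation)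
      (+-mono (flow-upper S cap≥0 edgeGL) (flow-upper S cap≥0 edgeVL))
      where
      gen-v : gen nodeV ≡ flow S edgeVL - flow S edgeGV
      gen-v = trans (sym (sub-zero (gen nodeV)))
                    (trans (cong (λ ℓ → gen nodeV - ℓ) (sym (load-off nodeV refl)))
                           (sym (balance-v S)))
      joint-generation : gen nodeG + gen nodeV ≡ flow S edgeGL + flow S edgeVL
      joint-generation = trans (cong₂ _+_ (balance-g S) gen-v)
                               (swap-summand (flow S edgeGV) (flow S edgeGL) (flow S edgeVL))

    gen-g-strict : 0# < gen nodeV → gen nodeG < x + x + x
    gen-g-strict (0≤gv , 0≢gv) = gen-g-bound S , λ g≡3x →
      0≢gv (antisym 0≤gv (nonpos-if-no-gain
        (subst (λ t → t + gen nodeV ≤ x + x + x) g≡3x joint-generation-bound)))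

lemma2 : (R : OrderedField) →
    let open OrderedField R
        open LDC R
    in
    (x : Carrier) → 0# ≤ x →
      MSF≡ (Nminus x) (x + x + x)
      × ((∀ (O : OptimalMSF (Nminus x)) →
            (Solution.load (OptimalMSF.solution O) nodeV ≡ 0#)
            ⊎ (Solution.load (OptimalMSF.solution O) nodeV ≡ x))
         × Σ (OptimalMSF (Nminus x))
             (λ O → Solution.load (OptimalMSF.solution O) nodeV ≡ 0#)
         × Σ (OptimalMSF (Nminus x))
             (λ O → Solution.load (OptimalMSF.solution O) nodeV ≡ x))
      × (∀ (O : OptimalMSF (Nplus x)) →
            0# < Solution.gen (OptimalMSF.solution O) nodeV →
            Solution.gen (OptimalMSF.solution O) nodeG < x + x + x)
lemma2 R x 0≤x =
  msf-minus
  , (load-v-cases , (optimal-through-v , refl) , (optimal-absorbed-at-v , refl))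
  , (λ O → gen-g-strict (OptimalMSF.solution O))
  where
  open LDC R using (OptimalMSF)
  open Triangle R x 0≤x
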